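{- Let $k\ge1$ be an integer and $j=2k+1$. Then $F_j/3$ is an integer and $e[F_j/3]=j2^j/F_j$. Moreover: <ul> <li>$e[n]\le e[F_j/3]$ for all integers $n$ with $2^{j-3}<n\le 2^{j-2}$ (i.e., $n$ in epoch $j-2$);</li> <li>$e[n]\le 1+e[F_j/3]$ for all integers $n$ with $2^{j-2}<n\le2^{j-1}$ (i.e., $n$ in epoch $j-1$).</li> </ul>
   Context: $F_j\doteq 2^j+1$. The $m$-th epoch is the set of integers $n$ with $2^{m-1}<n\le 2^m$. For an integer $n\ge1$, $e[n]$ is the expected number of fair coin tosses used by the bit-efficient scheme for choosing one of $n$ options uniformly. The scheme maintains a set of undecided equally likely toss sequences of the current length $t$ (probability $2^{ -t}$ each), starting with the empty sequence; if $n=1$, it stops immediately. After each toss, each undecided sequence splits into its two extensions. If there are now at least $n$ undecided sequences, $n$ of them are assigned one to each option, and the process stops if the observed sequence is among them; the rest remain undecided. Thus after $t$ tosses exactly $2^t\bmod n$ sequences are undecided. -}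

module Defs where

open import Data.Nat using (ℕ; zero; suc; _+_; _*_; _^_; _%_)
open import Data.Nat.Properties using (m^n≢0)
open import Data.Integer using (+_)
open import Data.Rational using (ℚ; _/_; 0ℚ; _≤_; _<_; _-_; Positive) renaming (_+_ to _+ℚ_)
open import Data.Product using (Σ; _×_)

-- F_j = 2^j + 1 (written 1 + 2^j so that it is visibly nonzero)
F : ℕ → ℕ
F j = 1 + 2 ^ j

-- number of undecided toss sequences after t tosses of the bit-efficient
-- scheme for n options: 2^t mod n  (n = 0 is meaningless; set to 0)
undecided : ℕ → ℕ → ℕ
undecided zero    t = 0
undecided (suc m) t = (2 ^ t) % suc m

-- P(T > t) = (2^t mod n) / 2^t, where T = number of tosses used
tailProb : ℕ → ℕ → ℚ
tailProb n t = (+ undecided n t) / (2 ^ t)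
  where instance _ = m^n≢0 2 t

partialSum : ℕ → ℕ → ℚ
partialSum n zero    = 0ℚ
partialSum n (suc T) = partialSum n T +ℚ tailProb n T

-- e[n] = E[T] = Σ_{t≥0} P(T > t) (tail-sum formula); since the partial sums
-- are nondecreasing, "e[n] = q" means q is their supremum, i.e. their limit:
IsExpectedTosses : ℕ → ℚ → Set
IsExpectedTosses n q =
  ((T : ℕ) → partialSum n T ≤ q) ×
  ((ε : ℚ) → Positive ε → Σ ℕ (λ T → q - ε < partialSum n T))

-- "e[n] ≤ q" (e[n] is the limit of nondecreasing partial sums)
ExpectedTossesAtMost : ℕ → ℚ → Set
ExpectedTossesAtMost n q = (T : ℕ) → partialSum n T ≤ q

{-# OPTIONS --safe #-}
module Submission where

-- Let W T = 2 ^ T · S n T for the partial sums S; then W (T + 1) = 2 W T + 2 (2 ^ T mod n).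
-- For n = F_j / 3 (odd, in epoch j - 1) we have 2 ^ j ≡ -1 mod n, so the remainders satisfy
-- r (T + j) + r T = n. Hence W grows geometrically along multiples of 2j, which pins down
-- e[n] = (W j + 2n) / F_j = j 2 ^ j / F_j. The two bounds follow from e[n] ≤ m + 1 on epoch m,
-- since 2k ≤ j 2 ^ j / F_j ≤ j.

open import Defs
open import Data.Nat using (ℕ; zero; suc; pred; _+_; _*_; _^_; _∸_; _/_; _%_; NonZero; z≤n; s≤s)
  renaming (_<_ to _<ℕ_; _≤_ to _≤ℕ_)
open import Data.Nat.Properties
open import Data.Nat.DivMod
  using (m%n<n; m%n%n≡m%n; %-distribˡ-*; [m+kn]%n≡m%n; m<n⇒m%n≡m; m≤n⇒[n∸m]%m≡n%m; m*n/n≡m)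
open import Data.Nat.Divisibility using (_∣_; divides)
open import Data.Nat.Tactic.RingSolver using (solve-∀)
open import Algebra.Properties.CommutativeSemigroup *-commutativeSemigroup using (x∙yz≈y∙xz)
open import Data.Integer as ℤ using (+_)
import Data.Integer.Properties as ℤ
open import Data.Rational using (ℚ; 1ℚ; mkℚ; Positive; toℚᵘ; -_; _-_)
  renaming (_/_ to _÷_; _+_ to _+ℚ_; _≤_ to _≤ℚ_; _<_ to _<ℚ_)
import Data.Rational.Properties as ℚ
open import Data.Rational.Unnormalised as ℚᵘ using (mkℚᵘ; *≡*; *≤*; *<*)
import Data.Rational.Unnormalised.Properties as ℚᵘ
open import Algebra.Properties.Group ℚ.+-0-group using (//-rightDividesʳ)
open import Data.Product using (Σ; _×_; _,_)
open import Relation.Binary.Definitions using (tri<; tri≈; tri>)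
open import Relation.Binary.PropositionalEquality
open import Relation.Nullary using (yes; no)
open import Data.Empty using (⊥-elim)

frac : (a b : ℕ) .{{_ : NonZero b}} → ℚ
frac a b = + a ÷ b

toℚᵘ-frac : ∀ a b .{{_ : NonZero b}} → toℚᵘ (frac a b) ℚᵘ.≃ mkℚᵘ (+ a) (pred b)
toℚᵘ-frac a (suc b) = ℚ.toℚᵘ-fromℚᵘ (mkℚᵘ (+ a) b)

+a*+b≡+[a*b] : ∀ a b → + a ℤ.* + b ≡ + (a * b)
+a*+b≡+[a*b] a b = ℤ.+◃n≡+n (a * b)

cross⇒frac≡ : ∀ a b c d .{{_ : NonZero b}} .{{_ : NonZero d}} → a * d ≡ c * b → frac a b ≡ frac c d
cross⇒frac≡ a b@(suc _) c d@(suc _) ad≡cb = ℚ.toℚᵘ-injective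
  (ℚᵘ.≃-trans (toℚᵘ-frac a b)
    (ℚᵘ.≃-trans (*≡* (trans (+a*+b≡+[a*b] a d) (trans (cong +_ ad≡cb) (sym (+a*+b≡+[a*b] c b)))))
      (ℚᵘ.≃-sym (toℚᵘ-frac c d))))

cross⇒frac≤ : ∀ a b c d .{{_ : NonZero b}} .{{_ : NonZero d}} → a * d ≤ℕ c * b → frac a b ≤ℚ frac c d
cross⇒frac≤ a b@(suc _) c d@(suc _) ad≤cb = ℚ.toℚᵘ-cancel-≤
  (ℚᵘ.≤-respˡ-≃ (ℚᵘ.≃-sym (toℚᵘ-frac a b)) (ℚᵘ.≤-respʳ-≃ (ℚᵘ.≃-sym (toℚᵘ-frac c d))
    (*≤* (subst₂ ℤ._≤_ (sym (+a*+b≡+[a*b] a d)) (sym (+a*+b≡+[a*b] c b)) (ℤ.+≤+ ad≤cb)))))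

cross⇒frac< : ∀ a b c d .{{_ : NonZero b}} .{{_ : NonZero d}} → a * d <ℕ c * b → frac a b <ℚ frac c d
cross⇒frac< a b@(suc _) c d@(suc _) ad<cb = ℚ.toℚᵘ-cancel-<
  (ℚᵘ.<-respˡ-≃ (ℚᵘ.≃-sym (toℚᵘ-frac a b)) (ℚᵘ.<-respʳ-≃ (ℚᵘ.≃-sym (toℚᵘ-frac c d))
    (*<* (subst₂ ℤ._<_ (sym (+a*+b≡+[a*b] a d)) (sym (+a*+b≡+[a*b] c b)) (ℤ.+<+ ad<cb)))))

frac-+ : ∀ a b c d .{{_ : NonZero b}} .{{_ : NonZero d}} →
  frac a b +ℚ frac c d ≡ frac (a * d + c * b) (b * d) {{m*n≢0 b d}}
frac-+ a b@(suc _) c d@(suc _) = ℚ.toℚᵘ-injective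
  (ℚᵘ.≃-trans (ℚ.toℚᵘ-homo-+ (frac a b) (frac c d))
    (ℚᵘ.≃-trans (ℚᵘ.+-cong (toℚᵘ-frac a b) (toℚᵘ-frac c d))
      (ℚᵘ.≃-trans (*≡* (cong (ℤ._* + (b * d)) (cong₂ ℤ._+_ (+a*+b≡+[a*b] a d) (+a*+b≡+[a*b] c b))))
        (ℚᵘ.≃-sym (toℚᵘ-frac (a * d + c * b) (b * d) {{m*n≢0 b d}})))))

positive⇒frac : ∀ ε → Positive ε → Σ ℕ λ p → Σ ℕ λ d → ε ≡ frac (suc p) (suc d)
positive⇒frac ε@(mkℚ (+ suc p) d _) _ = p , d , sym (ℚ.↥p/↧p≡p ε)

n<2^n : ∀ n → n <ℕ 2 ^ n
n<2^n zero    = s≤s z≤n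
n<2^n (suc n) = +-mono-≤ (m^n>0 2 n) (≤-trans (n<2^n n) (m≤m+n (2 ^ n) 0))

scaledSum : ℕ → ℕ → ℕ
scaledSum n zero    = 0
scaledSum n (suc T) = 2 * scaledSum n T + 2 * undecided n T

partialSum≡scaledSum : ∀ n T → partialSum n T ≡ frac (scaledSum n T) (2 ^ T) {{m^n≢0 2 T}}
partialSum≡scaledSum n zero    = refl
partialSum≡scaledSum n (suc T) = begin
  partialSum n T +ℚ tailProb n T
    ≡⟨ cong (_+ℚ tailProb n T) (partialSum≡scaledSum n T) ⟩
  frac W U +ℚ frac r U
    ≡⟨ frac-+ W U r U ⟩
  frac (W * U + r * U) (U * U) {{m*n≢0 U U}}
    ≡⟨ cross⇒frac≡ (W * U + r * U) (U * U) (2 * W + 2 * r) (2 * U) {{m*n≢0 U U}} (cross W r U) ⟩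
  frac (2 * W + 2 * r) (2 * U) ∎
  where
  open ≡-Reasoning
  W = scaledSum n T
  r = undecided n T
  U = 2 ^ T
  instance
    U≢0 = m^n≢0 2 T
    2U≢0 = m^n≢0 2 (suc T)
  cross : ∀ w r u → (w * u + r * u) * (2 * u) ≡ (2 * w + 2 * r) * (u * u)
  cross = solve-∀

expectedTossesAtMost-mono : ∀ {n q q′} → q ≤ℚ q′ → ExpectedTossesAtMost n q → ExpectedTossesAtMost n q′
expectedTossesAtMost-mono q≤q′ bound T = ℚ.≤-trans (bound T) q≤q′

expectedTossesAtMost-scaled : ∀ n a b .{{_ : NonZero b}} →
  (∀ T → scaledSum n T * b ≤ℕ a * 2 ^ T) → ExpectedTossesAtMost n (frac a b)
expectedTossesAtMost-scaled n a b upper T =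
  subst (_≤ℚ frac a b) (sym (partialSum≡scaledSum n T))
    (cross⇒frac≤ (scaledSum n T) (2 ^ T) a b {{m^n≢0 2 T}} (upper T))

isExpectedTosses-scaled : ∀ n a b .{{_ : NonZero b}} →
  (∀ T → scaledSum n T * b ≤ℕ a * 2 ^ T) →
  (∀ N → Σ ℕ λ T → N <ℕ 2 ^ T × a * 2 ^ T ≤ℕ scaledSum n T * b + a) →
  IsExpectedTosses n (frac a b)
isExpectedTosses-scaled n a b@(suc b′) upper approach = expectedTossesAtMost-scaled n a b upper , close
  where
  close : (ε : ℚ) → Positive ε → Σ ℕ λ T → frac a b - ε <ℚ partialSum n T
  close ε ε>0 with positive⇒frac ε ε>0
  ... | p , d , refl with approach (a * suc d)
  ...   | T , aE<U , aU≤Wb+a = T , subst (frac a b - ε <ℚ_) (sym (partialSum≡scaledSum n T)) a/b-ε<W/U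
    where
    E = suc d
    U = 2 ^ T
    W = scaledSum n T
    instance
      U≢0 = m^n≢0 2 T
      UE≢0 = m*n≢0 U E
    -- a/b < W/U + ε reduces to a·E < U·(1+p)·b, and a·E < U by the choice of T.
    aUE<[WE+pU]b : a * (U * E) <ℕ (W * E + suc p * U) * b
    aUE<[WE+pU]b = begin-strict
      a * (U * E)             ≡⟨ regroup a U E ⟩
      a * U * E               ≤⟨ *-monoˡ-≤ E aU≤Wb+a ⟩
      (W * b + a) * E         ≡⟨ *-distribʳ-+ E (W * b) a ⟩
      W * b * E + a * E       <⟨ +-monoʳ-< (W * b * E) aE<U ⟩
      W * b * E + U           ≤⟨ +-monoʳ-≤ (W * b * E) (≤-trans (m≤n*m U (suc p)) (m≤m*n (suc p * U) b)) ⟩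
      W * b * E + suc p * U * b ≡⟨ reassociate W b E (suc p * U) ⟩
      (W * E + suc p * U) * b ∎
      where
      open ≤-Reasoning
      regroup : ∀ a U E → a * (U * E) ≡ a * U * E
      regroup = solve-∀
      reassociate : ∀ W b E pU → W * b * E + pU * b ≡ (W * E + pU) * b
      reassociate = solve-∀
    a/b<W/U+ε : frac a b <ℚ frac W U +ℚ frac (suc p) E
    a/b<W/U+ε = subst (frac a b <ℚ_) (sym (frac-+ W U (suc p) E))
      (cross⇒frac< a b (W * E + suc p * U) (U * E) aUE<[WE+pU]b)
    a/b-ε<W/U : frac a b - frac (suc p) E <ℚ frac W U
    a/b-ε<W/U = subst (frac a b - frac (suc p) E <ℚ_) (//-rightDividesʳ (frac (suc p) E) (frac W U))
      (ℚ.+-monoˡ-< (- frac (suc p) E) a/b<W/U+ε)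

undecided<n : ∀ n′ T → undecided (suc n′) T <ℕ suc n′
undecided<n n′ T = m%n<n (2 ^ T) (suc n′)

undecided-suc : ∀ n′ T → undecided (suc n′) (suc T) ≡ (2 * undecided (suc n′) T) % suc n′
undecided-suc n′ T = begin
  (2 * 2 ^ T) % n                     ≡⟨ %-distribˡ-* 2 (2 ^ T) n ⟩
  (2 % n * (2 ^ T % n)) % n           ≡⟨ cong (λ x → (2 % n * x) % n) (sym (m%n%n≡m%n (2 ^ T) n)) ⟩
  (2 % n * (2 ^ T % n % n)) % n       ≡⟨ sym (%-distribˡ-* 2 (2 ^ T % n) n) ⟩
  (2 * (2 ^ T % n)) % n               ∎
  where
  open ≡-Reasoning
  n = suc n′

scaledSum-shift-mono : ∀ n d T → 2 ^ d * scaledSum n T ≤ℕ scaledSum n (d + T)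
scaledSum-shift-mono n zero    T = ≤-reflexive (*-identityˡ (scaledSum n T))
scaledSum-shift-mono n (suc d) T = begin
  2 * 2 ^ d * scaledSum n T        ≡⟨ *-assoc 2 (2 ^ d) (scaledSum n T) ⟩
  2 * (2 ^ d * scaledSum n T)      ≤⟨ *-monoʳ-≤ 2 (scaledSum-shift-mono n d T) ⟩
  2 * scaledSum n (d + T)          ≤⟨ m≤m+n _ _ ⟩
  scaledSum n (suc d + T)          ∎
  where open ≤-Reasoning

scaledSum-periodic : ∀ n P → (∀ T → undecided n (T + P) ≡ undecided n T) →
  ∀ T → scaledSum n (T + P) ≡ 2 ^ T * scaledSum n P + scaledSum n T
scaledSum-periodic n P period zero    = sym (trans (+-identityʳ _) (*-identityˡ (scaledSum n P)))
scaledSum-periodic n P period (suc T) rewrite scaledSum-periodic n P period T | period T =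
  distribute (2 ^ T) (scaledSum n P) (scaledSum n T) (undecided n T)
  where
  distribute : ∀ u x y z → 2 * (u * x + y) + 2 * z ≡ 2 * u * x + (2 * y + 2 * z)
  distribute = solve-∀

-- On epoch m (2 ^ m < 2n and n ≤ 2 ^ m) no toss before the m-th can stop, so W T = T 2 ^ T for
-- T ≤ m; afterwards W T + 2n ≤ (m + 1) 2 ^ T is preserved as fewer than n sequences stay undecided.
module Epoch (m n′ : ℕ) (2^m<2n : 2 ^ m <ℕ 2 * suc n′) (n≤2^m : suc n′ ≤ℕ 2 ^ m) where

  private
    n = suc n′
    W = scaledSum n
    r = undecided n

  undecided-before : ∀ {T} → T <ℕ m → r T ≡ 2 ^ T
  undecided-before {T} T<m = m<n⇒m%n≡m (*-cancelˡ-< 2 (2 ^ T) n (≤-<-trans (^-monoʳ-≤ 2 T<m) 2^m<2n))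

  scaledSum-before : ∀ {T} → T ≤ℕ m → W T ≡ T * 2 ^ T
  scaledSum-before {zero}  _    = refl
  scaledSum-before {suc T} T<m rewrite scaledSum-before (<⇒≤ T<m) | undecided-before T<m =
    collect T (2 ^ T)
    where
    collect : ∀ t x → 2 * (t * x) + 2 * x ≡ suc t * (2 * x)
    collect = solve-∀

  n+undecided≡2^m : n + r m ≡ 2 ^ m
  n+undecided≡2^m = begin
    n + (2 ^ m) % n               ≡⟨ cong (λ x → n + x) (sym (m≤n⇒[n∸m]%m≡n%m n≤2^m)) ⟩
    n + (2 ^ m ∸ n) % n           ≡⟨ cong (λ x → n + x) (m<n⇒m%n≡m 2^m∸n<n) ⟩
    n + (2 ^ m ∸ n)               ≡⟨ m+[n∸m]≡n n≤2^m ⟩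
    2 ^ m                         ∎
    where
    open ≡-Reasoning
    2^m∸n<n : 2 ^ m ∸ n <ℕ n
    2^m∸n<n = m<n+o⇒m∸n<o (2 ^ m) n (subst (2 ^ m <ℕ_) (cong (λ x → n + x) (+-identityʳ n)) 2^m<2n)

  scaledSum-after : W (suc m) + 2 * n ≡ suc m * 2 ^ suc m
  scaledSum-after = begin
    2 * W m + 2 * r m + 2 * n     ≡⟨ cong (λ x → 2 * x + 2 * r m + 2 * n) (scaledSum-before ≤-refl) ⟩
    2 * (m * 2 ^ m) + 2 * r m + 2 * n ≡⟨ regroup (m * 2 ^ m) (r m) n ⟩
    2 * (m * 2 ^ m) + 2 * (n + r m) ≡⟨ cong (λ x → 2 * (m * 2 ^ m) + 2 * x) n+undecided≡2^m ⟩
    2 * (m * 2 ^ m) + 2 * 2 ^ m   ≡⟨ collect m (2 ^ m) ⟩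
    suc m * 2 ^ suc m             ∎
    where
    open ≡-Reasoning
    regroup : ∀ x y z → 2 * x + 2 * y + 2 * z ≡ 2 * x + 2 * (z + y)
    regroup = solve-∀
    collect : ∀ t x → 2 * (t * x) + 2 * x ≡ suc t * (2 * x)
    collect = solve-∀

  scaledSum-after-bound : ∀ d → W (d + suc m) + 2 * n ≤ℕ suc m * 2 ^ (d + suc m)
  scaledSum-after-bound zero = ≤-reflexive scaledSum-after
  scaledSum-after-bound (suc d) = begin
    2 * w + 2 * r t + 2 * n       ≤⟨ +-monoˡ-≤ (2 * n) (+-monoʳ-≤ (2 * w) (*-monoʳ-≤ 2 (<⇒≤ (undecided<n n′ t)))) ⟩
    2 * w + 2 * n + 2 * n         ≡⟨ factor w n ⟩
    2 * (w + 2 * n)               ≤⟨ *-monoʳ-≤ 2 (scaledSum-after-bound d) ⟩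
    2 * (suc m * 2 ^ t)           ≡⟨ swap (suc m) (2 ^ t) ⟩
    suc m * 2 ^ suc t             ∎
    where
    open ≤-Reasoning
    t = d + suc m
    w = W t
    factor : ∀ w n → 2 * w + 2 * n + 2 * n ≡ 2 * (w + 2 * n)
    factor = solve-∀
    swap : ∀ x y → 2 * (x * y) ≡ x * (2 * y)
    swap = solve-∀

  scaledSum-bound : ∀ T → W T ≤ℕ suc m * 2 ^ T
  scaledSum-bound T with T ≤? m
  ... | yes T≤m = ≤-trans (≤-reflexive (scaledSum-before T≤m)) (*-monoˡ-≤ (2 ^ T) (m≤n⇒m≤1+n T≤m))
  ... | no  T≰m = subst (λ t → W t ≤ℕ suc m * 2 ^ t) (m∸n+n≡m m<T)
                    (≤-trans (m≤m+n _ _) (scaledSum-after-bound (T ∸ suc m)))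
    where m<T = ≰⇒> T≰m

expectedTossesAtMost-epoch : ∀ m n → 2 ^ m <ℕ n → n ≤ℕ 2 ^ suc m → ExpectedTossesAtMost n (frac (2 + m) 1)
expectedTossesAtMost-epoch m (suc n′) 2^m<n n≤2^[1+m] = expectedTossesAtMost-scaled (suc n′) (2 + m) 1 bound
  where
  bound : ∀ T → scaledSum (suc n′) T * 1 ≤ℕ (2 + m) * 2 ^ T
  bound T = ≤-trans (≤-reflexive (*-identityʳ _))
    (Epoch.scaledSum-bound (suc m) n′ (*-monoʳ-< 2 2^m<n) n≤2^[1+m] T)

below-half⇒above-half : ∀ {x y n} → x + y ≡ n + n → x <ℕ n → n <ℕ y
below-half⇒above-half {x} {y} {n} x+y≡n+n x<n =
  +-cancelˡ-< n n y (subst (_<ℕ n + y) x+y≡n+n (+-monoˡ-< y x<n))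

above-half⇒below-half : ∀ {x y n} → x + y ≡ n + n → n <ℕ x → y <ℕ n
above-half⇒below-half {x} {y} {n} x+y≡n+n n<x =
  +-cancelʳ-< n y n (subst (y + n <ℕ_) (trans (+-comm y x) x+y≡n+n) (+-monoʳ-< y n<x))

double≡n+n : ∀ a b {n} → a + b ≡ n → 2 * a + 2 * b ≡ n + n
double≡n+n a b {n} a+b≡n = trans (sym (*-distribˡ-+ 2 a b)) (trans (cong (2 *_) a+b≡n) (cong (λ x → n + x) (+-identityʳ n)))

double-complement-small : ∀ {n a b} .{{_ : NonZero n}} → a + b ≡ n → b <ℕ n → 2 * a <ℕ n →
  (2 * a) % n + (2 * b) % n ≡ n
double-complement-small {n} {a} {b} a+b≡n b<n 2a<n = begin
  (2 * a) % n + (2 * b) % n     ≡⟨ cong₂ _+_ (m<n⇒m%n≡m 2a<n) (sym (m≤n⇒[n∸m]%m≡n%m (<⇒≤ n<2b))) ⟩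
  2 * a + (2 * b ∸ n) % n       ≡⟨ cong (λ x → 2 * a + x) (m<n⇒m%n≡m (m<n+o⇒m∸n<o (2 * b) n 2b<n+n)) ⟩
  2 * a + (2 * b ∸ n)           ≡⟨ sym (+-∸-assoc (2 * a) (<⇒≤ n<2b)) ⟩
  2 * a + 2 * b ∸ n             ≡⟨ cong (_∸ n) (double≡n+n a b a+b≡n) ⟩
  n + n ∸ n                     ≡⟨ m+n∸n≡m n n ⟩
  n                             ∎
  where
  open ≡-Reasoning
  n<2b : n <ℕ 2 * b
  n<2b = below-half⇒above-half (double≡n+n a b a+b≡n) 2a<n
  2b<n+n : 2 * b <ℕ n + n
  2b<n+n = subst (2 * b <ℕ_) (cong (λ x → n + x) (+-identityʳ n)) (*-monoʳ-< 2 b<n)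

-- Modulo an odd n, doubling preserves the relation a + b ≡ n, since 2a ≢ n.
double-complement : ∀ e {a b} → a + b ≡ suc (2 * e) → a <ℕ suc (2 * e) → b <ℕ suc (2 * e) →
  (2 * a) % suc (2 * e) + (2 * b) % suc (2 * e) ≡ suc (2 * e)
double-complement e {a} {b} a+b≡n a<n b<n with <-cmp (2 * a) (suc (2 * e))
... | tri< 2a<n _ _ = double-complement-small a+b≡n b<n 2a<n
... | tri≈ _ 2a≡n _ = ⊥-elim (even≢odd a e 2a≡n)
... | tri> _ _ n<2a = trans (+-comm ((2 * a) % suc (2 * e)) _)
  (double-complement-small (trans (+-comm b a) a+b≡n) a<n
    (above-half⇒below-half (double≡n+n a b a+b≡n) n<2a))

-- If 2 ^ h ≡ -1 modulo an odd n, the undecided counts satisfy r (T + h) + r T ≡ n, so they have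
-- period 2h and the partial sums grow geometrically along multiples of 2h.
module Antiperiodic (e h′ : ℕ)
  (antiperiodic₀ : undecided (suc (2 * e)) (suc h′) + undecided (suc (2 * e)) 0 ≡ suc (2 * e)) where

  n = suc (2 * e)
  h = suc h′
  c = scaledSum n h + 2 * n
  D = 1 + 2 ^ h

  private
    r = undecided n
    W = scaledSum n
    P = h + h

  undecided-antiperiodic : ∀ T → r (T + h) + r T ≡ n
  undecided-antiperiodic zero    = antiperiodic₀
  undecided-antiperiodic (suc T) rewrite undecided-suc (2 * e) (T + h) | undecided-suc (2 * e) T =
    double-complement e (undecided-antiperiodic T) (undecided<n (2 * e) (T + h)) (undecided<n (2 * e) T)

  undecided-periodic : ∀ T → r (T + P) ≡ r T
  undecided-periodic T = +-cancelʳ-≡ (r (T + h)) (r (T + P)) (r T) (begin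
    r (T + P) + r (T + h)          ≡⟨ cong (λ t → r t + r (T + h)) (sym (+-assoc T h h)) ⟩
    r (T + h + h) + r (T + h)      ≡⟨ undecided-antiperiodic (T + h) ⟩
    n                              ≡⟨ sym (undecided-antiperiodic T) ⟩
    r (T + h) + r T                ≡⟨ +-comm (r (T + h)) (r T) ⟩
    r T + r (T + h)                ∎)
    where open ≡-Reasoning

  scaledSum-antiperiodic : ∀ T → W (T + h) + W T + 2 * n ≡ 2 ^ T * c
  scaledSum-antiperiodic zero    = trans (cong (_+ 2 * n) (+-identityʳ (W h))) (sym (*-identityˡ c))
  scaledSum-antiperiodic (suc T) = begin
    (2 * X + 2 * a) + (2 * Y + 2 * b) + 2 * n       ≡⟨ cong (λ x → (2 * X + 2 * a) + (2 * Y + 2 * b) + 2 * x)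
                                                          (sym (undecided-antiperiodic T)) ⟩
    (2 * X + 2 * a) + (2 * Y + 2 * b) + 2 * (a + b) ≡⟨ regroup X Y a b ⟩
    2 * (X + Y + 2 * (a + b))                       ≡⟨ cong (λ x → 2 * (X + Y + 2 * x)) (undecided-antiperiodic T) ⟩
    2 * (X + Y + 2 * n)                             ≡⟨ cong (2 *_) (scaledSum-antiperiodic T) ⟩
    2 * (2 ^ T * c)                                 ≡⟨ sym (*-assoc 2 (2 ^ T) c) ⟩
    2 ^ suc T * c                                   ∎
    where
    open ≡-Reasoning
    X = W (T + h)
    Y = W T
    a = r (T + h)
    b = r T
    regroup : ∀ X Y a b → (2 * X + 2 * a) + (2 * Y + 2 * b) + 2 * (a + b) ≡ 2 * (X + Y + 2 * (a + b))
    regroup = solve-∀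

  scaledSum-cycle : W P * D + c ≡ c * 2 ^ P
  scaledSum-cycle = begin
    W P * (1 + A) + c              ≡⟨ regroup (W P) A c ⟩
    (W P + c) + A * W P            ≡⟨ cong (_+ A * W P) WP+c≡Ac ⟩
    A * c + A * W P                ≡⟨ sym (*-distribˡ-+ A c (W P)) ⟩
    A * (c + W P)                  ≡⟨ cong (A *_) (trans (+-comm c (W P)) WP+c≡Ac) ⟩
    A * (A * c)                    ≡⟨ reorder A c ⟩
    c * (A * A)                    ≡⟨ cong (c *_) (sym (^-distribˡ-+-* 2 h h)) ⟩
    c * 2 ^ P                      ∎
    where
    open ≡-Reasoning
    A = 2 ^ h
    WP+c≡Ac : W P + c ≡ A * c
    WP+c≡Ac = trans (sym (+-assoc (W P) (W h) (2 * n))) (scaledSum-antiperiodic h)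
    regroup : ∀ w a c → w * (1 + a) + c ≡ (w + c) + a * w
    regroup = solve-∀
    reorder : ∀ a c → a * (a * c) ≡ c * (a * a)
    reorder = solve-∀

  scaledSum-multiple : ∀ i → W (i * P) * D + c ≡ c * 2 ^ (i * P)
  scaledSum-multiple zero    = sym (*-identityʳ c)
  scaledSum-multiple (suc i) = begin
    W (P + i * P) * D + c          ≡⟨ cong (λ t → W t * D + c) (+-comm P (i * P)) ⟩
    W (i * P + P) * D + c          ≡⟨ cong (λ x → x * D + c) (scaledSum-periodic n P undecided-periodic (i * P)) ⟩
    (U * W P + W (i * P)) * D + c  ≡⟨ regroup U (W P) (W (i * P)) D c ⟩
    U * (W P * D) + (W (i * P) * D + c) ≡⟨ cong (λ x → U * (W P * D) + x) (scaledSum-multiple i) ⟩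
    U * (W P * D) + c * U          ≡⟨ factor U (W P * D) c ⟩
    U * (W P * D + c)              ≡⟨ cong (U *_) scaledSum-cycle ⟩
    U * (c * 2 ^ P)                ≡⟨ reorder U c (2 ^ P) ⟩
    c * (2 ^ P * U)                ≡⟨ cong (c *_) (sym (^-distribˡ-+-* 2 P (i * P))) ⟩
    c * 2 ^ (P + i * P)            ∎
    where
    open ≡-Reasoning
    U = 2 ^ (i * P)
    regroup : ∀ u x y d c → (u * x + y) * d + c ≡ u * (x * d) + (y * d + c)
    regroup = solve-∀
    factor : ∀ u x c → u * x + c * u ≡ u * (x + c)
    factor = solve-∀
    reorder : ∀ u c p → u * (c * p) ≡ c * (p * u)
    reorder = solve-∀

  -- Shift T up to the multiple T * P of the period, where the bound is exact.
  scaledSum-upper : ∀ T → W T * D ≤ℕ c * 2 ^ T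
  scaledSum-upper T = *-cancelˡ-≤ (2 ^ d) {{m^n≢0 2 d}} (begin
    2 ^ d * (W T * D)              ≡⟨ sym (*-assoc (2 ^ d) (W T) D) ⟩
    2 ^ d * W T * D                ≤⟨ *-monoˡ-≤ D (scaledSum-shift-mono n d T) ⟩
    W (d + T) * D                  ≤⟨ m≤m+n _ c ⟩
    W (d + T) * D + c              ≡⟨ cong (λ t → W t * D + c) d+T≡TP ⟩
    W (T * P) * D + c              ≡⟨ scaledSum-multiple T ⟩
    c * 2 ^ (T * P)                ≡⟨ cong (λ t → c * 2 ^ t) (sym d+T≡TP) ⟩
    c * 2 ^ (d + T)                ≡⟨ cong (c *_) (^-distribˡ-+-* 2 d T) ⟩
    c * (2 ^ d * 2 ^ T)            ≡⟨ x∙yz≈y∙xz c (2 ^ d) (2 ^ T) ⟩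
    2 ^ d * (c * 2 ^ T)            ∎)
    where
    open ≤-Reasoning
    d = T * P ∸ T
    d+T≡TP : d + T ≡ T * P
    d+T≡TP = m∸n+n≡m (m≤m*n T P)

  isExpectedTosses-antiperiodic : IsExpectedTosses n (frac c D)
  isExpectedTosses-antiperiodic = isExpectedTosses-scaled n c D scaledSum-upper approach
    where
    approach : ∀ N → Σ ℕ λ T → N <ℕ 2 ^ T × c * 2 ^ T ≤ℕ W T * D + c
    approach N = N * P , ≤-trans (n<2^n N) (^-monoʳ-≤ 2 (m≤m*n N P)) , ≤-reflexive (sym (scaledSum-multiple N))

repunit₄ : ℕ → ℕ
repunit₄ zero    = 0
repunit₄ (suc k) = 4 * repunit₄ k + 1

2^[2k]≡1+3*repunit₄ : ∀ k → 2 ^ (2 * k) ≡ 1 + 3 * repunit₄ k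
2^[2k]≡1+3*repunit₄ zero    = refl
2^[2k]≡1+3*repunit₄ (suc k) = begin
  2 ^ (2 * suc k)                  ≡⟨ cong (2 ^_) (*-suc 2 k) ⟩
  2 * (2 * 2 ^ (2 * k))            ≡⟨ sym (*-assoc 2 2 (2 ^ (2 * k))) ⟩
  4 * 2 ^ (2 * k)                  ≡⟨ cong (4 *_) (2^[2k]≡1+3*repunit₄ k) ⟩
  4 * (1 + 3 * repunit₄ k)         ≡⟨ expand (repunit₄ k) ⟩
  1 + 3 * (4 * repunit₄ k + 1)     ∎
  where
  open ≡-Reasoning
  expand : ∀ r → 4 * (1 + 3 * r) ≡ 1 + 3 * (4 * r + 1)
  expand = solve-∀

-- n = F j / 3 for j = 2k + 1, written as the odd number 1 + 2 (4 ^ k - 1) / 3.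
module ThirdOfF (k′ : ℕ) where

  k = suc k′
  j = 2 * k + 1
  R = repunit₄ k
  n = suc (2 * R)
  e = frac (j * 2 ^ j) (F j)

  j≡suc[2k] : j ≡ suc (2 * k)
  j≡suc[2k] = +-comm (2 * k) 1

  j≡3+2k′ : j ≡ 3 + 2 * k′
  j≡3+2k′ = expand k′
    where
    expand : ∀ k′ → 2 * suc k′ + 1 ≡ 3 + 2 * k′
    expand = solve-∀

  2^j≡2+6R : 2 ^ j ≡ 2 * (1 + 3 * R)
  2^j≡2+6R = trans (cong (2 ^_) j≡suc[2k]) (cong (2 *_) (2^[2k]≡1+3*repunit₄ k))

  F≡n*3 : F j ≡ n * 3
  F≡n*3 = trans (cong suc 2^j≡2+6R) (regroup R)
    where
    regroup : ∀ r → 1 + 2 * (1 + 3 * r) ≡ suc (2 * r) * 3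
    regroup = solve-∀

  2^[2k]<2n : 2 ^ (2 * k) <ℕ 2 * n
  2^[2k]<2n = subst₂ _<ℕ_ (sym (2^[2k]≡1+3*repunit₄ k)) (expand R) (≤-trans (m≤m+n (2 + 3 * R) R) ≤-refl)
    where
    expand : ∀ r → 2 + 3 * r + r ≡ 2 * suc (2 * r)
    expand = solve-∀

  n≤2^[2k] : n ≤ℕ 2 ^ (2 * k)
  n≤2^[2k] = subst (n ≤ℕ_) (sym (2^[2k]≡1+3*repunit₄ k)) (s≤s (*-monoˡ-≤ R {2} {3} (s≤s (s≤s z≤n))))

  antiperiodic₀ : undecided n (suc (2 * k)) + undecided n 0 ≡ n
  antiperiodic₀ = trans (cong₂ _+_ undecided-j undecided-0) (+-comm (2 * R) 1)
    where
    undecided-j : undecided n (suc (2 * k)) ≡ 2 * R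
    undecided-j = begin
      2 ^ suc (2 * k) % n           ≡⟨ cong (_% n) (trans (sym (cong (2 ^_) j≡suc[2k])) 2^j≡2+6R) ⟩
      2 * (1 + 3 * R) % n           ≡⟨ cong (_% n) (expand R) ⟩
      (2 * R + 2 * n) % n           ≡⟨ [m+kn]%n≡m%n (2 * R) 2 n ⟩
      (2 * R) % n                   ≡⟨ m<n⇒m%n≡m ≤-refl ⟩
      2 * R                         ∎
      where
      open ≡-Reasoning
      expand : ∀ r → 2 * (1 + 3 * r) ≡ 2 * r + 2 * suc (2 * r)
      expand = solve-∀
    undecided-0 : undecided n 0 ≡ 1
    undecided-0 = m<n⇒m%n≡m (s≤s (≤-trans (m≤n+m 1 (4 * repunit₄ k′)) (m≤m+n R (R + 0))))

  isExpectedTosses-third : IsExpectedTosses n e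
  isExpectedTosses-third =
    subst (IsExpectedTosses n) (sym (cong (λ t → frac (t * 2 ^ t) (F t)) j≡suc[2k]))
      (subst (λ x → IsExpectedTosses n (frac x D)) (Epoch.scaledSum-after (2 * k) (2 * R) 2^[2k]<2n n≤2^[2k])
        isExpectedTosses-antiperiodic)
    where open Antiperiodic R (2 * k) antiperiodic₀ using (D; isExpectedTosses-antiperiodic)

  2+2k′≤e : frac (2 + 2 * k′) 1 ≤ℚ e
  2+2k′≤e = cross⇒frac≤ (2 + 2 * k′) 1 (j * 2 ^ j) (F j)
    (subst (λ t → (2 + 2 * k′) * F t ≤ℕ t * 2 ^ t * 1) (sym j≡3+2k′)
      (≤-trans (m*[1+A]≤[1+m]*A (2 + 2 * k′) (2 ^ (3 + 2 * k′)) (<⇒≤ (≤-trans (n≤1+n _) (n<2^n (3 + 2 * k′)))))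
        (≤-reflexive (sym (*-identityʳ _)))))
    where
    m*[1+A]≤[1+m]*A : ∀ m A → m ≤ℕ A → m * (1 + A) ≤ℕ suc m * A
    m*[1+A]≤[1+m]*A m A m≤A = begin
      m * (1 + A)                 ≡⟨ *-distribˡ-+ m 1 A ⟩
      m * 1 + m * A               ≤⟨ +-monoˡ-≤ (m * A) (≤-trans (≤-reflexive (*-identityʳ m)) m≤A) ⟩
      suc m * A                   ∎
      where open ≤-Reasoning

  3+2k′≤1+e : frac (3 + 2 * k′) 1 ≤ℚ 1ℚ +ℚ e
  3+2k′≤1+e = subst (frac (3 + 2 * k′) 1 ≤ℚ_) (sym (frac-+ 1 1 (j * 2 ^ j) (F j)))
    (cross⇒frac≤ (3 + 2 * k′) 1 (1 * F j + j * 2 ^ j * 1) (1 * F j)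
      (subst (λ t → t * (1 * F j) ≤ℕ (1 * F j + j * 2 ^ j * 1) * 1) j≡3+2k′
        (t*[1+A]≤1+A+t*A j (2 ^ j) (≤-trans (<⇒≤ (n<2^n j)) (n≤1+n _)))))
    where
    t*[1+A]≤1+A+t*A : ∀ t A → t ≤ℕ 1 + A → t * (1 * (1 + A)) ≤ℕ (1 * (1 + A) + t * A * 1) * 1
    t*[1+A]≤1+A+t*A t A t≤1+A = begin
      t * (1 * (1 + A))           ≡⟨ expand t A ⟩
      t + t * A                   ≤⟨ +-monoˡ-≤ (t * A) t≤1+A ⟩
      1 + A + t * A               ≡⟨ pad t A ⟩
      (1 * (1 + A) + t * A * 1) * 1 ∎
      where
      open ≤-Reasoning
      expand : ∀ t A → t * (1 * (1 + A)) ≡ t + t * A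
      expand = solve-∀
      pad : ∀ t A → 1 + A + t * A ≡ (1 * (1 + A) + t * A * 1) * 1
      pad = solve-∀

proposition10 : (k : ℕ) → 1 ≤ℕ k →
    (3 ∣ F (2 * k + 1))
    × IsExpectedTosses (F (2 * k + 1) / 3) ((+ ((2 * k + 1) * 2 ^ (2 * k + 1))) ÷ F (2 * k + 1))
    × ((n : ℕ) → 2 ^ (2 * k + 1 ∸ 3) <ℕ n → n ≤ℕ 2 ^ (2 * k + 1 ∸ 2) →
        ExpectedTossesAtMost n ((+ ((2 * k + 1) * 2 ^ (2 * k + 1))) ÷ F (2 * k + 1)))
    × ((n : ℕ) → 2 ^ (2 * k + 1 ∸ 2) <ℕ n → n ≤ℕ 2 ^ (2 * k + 1 ∸ 1) →
        ExpectedTossesAtMost n (1ℚ +ℚ (+ ((2 * k + 1) * 2 ^ (2 * k + 1))) ÷ F (2 * k + 1)))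
proposition10 zero ()
proposition10 (suc k′) _ =
  divides n F≡n*3 ,
  subst (λ m → IsExpectedTosses m e) (sym F/3≡n) isExpectedTosses-third ,
  (λ m lo hi → expectedTossesAtMost-mono 2+2k′≤e
    (expectedTossesAtMost-epoch (2 * k′) m (subst (_<ℕ m) (2^[j∸d] 3) lo) (subst (m ≤ℕ_) (2^[j∸d] 2) hi))) ,
  (λ m lo hi → expectedTossesAtMost-mono 3+2k′≤1+e
    (expectedTossesAtMost-epoch (suc (2 * k′)) m (subst (_<ℕ m) (2^[j∸d] 2) lo) (subst (m ≤ℕ_) (2^[j∸d] 1) hi)))
  where
  open ThirdOfF k′
  F/3≡n : F j / 3 ≡ n
  F/3≡n = trans (cong (_/ 3) F≡n*3) (m*n/n≡m n 3)
  2^[j∸d] : ∀ d → 2 ^ (j ∸ d) ≡ 2 ^ (3 + 2 * k′ ∸ d)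
  2^[j∸d] d = cong (λ t → 2 ^ (t ∸ d)) j≡3+2k′
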